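{- If a vertex-transitive graph $\Gamma$ has an inclusion-maximal clique of size $|V(\Gamma)|/2$, then $\Gamma$ is localizable.
   Context: All graphs are finite and simple. A clique is strong if it intersects every inclusion-maximal independent set. A graph is localizable if its vertex set can be partitioned into strong cliques. A graph is vertex-transitive if its automorphism group acts transitively on its vertices. -}

module Defs where

open import Data.Nat using (ℕ)
open import Data.Fin using (Fin)
open import Data.Fin.Properties using (_≟_)
open import Data.Fin.Subset using (Subset; _∈_; _⊆_; ∣_∣)
open import Data.Vec using (tabulate)
open import Data.Product using (∃; _×_)
open import Data.Empty using (⊥)
open import Relation.Nullary using (¬_)
open import Relation.Nullary.Decidable using (⌊_⌋)
open import Relation.Binary.PropositionalEquality using (_≡_)
open import Function.Bundles using (_↔_; Inverse)

record Graph (n : ℕ) : Set₁ where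
  field
    Adj    : Fin n → Fin n → Set
    sym    : ∀ {u v} → Adj u v → Adj v u
    irrefl : ∀ {v} → ¬ Adj v v
open Graph public

module _ {n : ℕ} (G : Graph n) where

  IsClique : Subset n → Set
  IsClique C = ∀ {u v} → u ∈ C → v ∈ C → ¬ (u ≡ v) → Adj G u v

  IsIndependent : Subset n → Set
  IsIndependent I = ∀ {u v} → u ∈ I → v ∈ I → ¬ Adj G u v

  IsMaximalClique : Subset n → Set
  IsMaximalClique C = IsClique C × (∀ D → IsClique D → C ⊆ D → D ⊆ C)

  IsMaximalIndependent : Subset n → Set
  IsMaximalIndependent I =
    IsIndependent I × (∀ J → IsIndependent J → I ⊆ J → J ⊆ I)

  IsStrongClique : Subset n → Set
  IsStrongClique C =
    IsClique C × (∀ I → IsMaximalIndependent I → ∃ λ v → v ∈ C × v ∈ I)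

  classOf : {k : ℕ} → (Fin n → Fin k) → Fin k → Subset n
  classOf f i = tabulate (λ v → ⌊ f v ≟ i ⌋)

  -- V(G) can be partitioned into strong cliques: a partition is given by
  -- an assignment of every vertex to one of k parts, each part a strong clique
  -- (strong cliques are nonempty when n ≥ 1, so parts are nonempty then).
  IsLocalizable : Set
  IsLocalizable = ∃ λ k → ∃ λ (f : Fin n → Fin k) → ∀ i → IsStrongClique (classOf f i)

  IsAutomorphism : (Fin n ↔ Fin n) → Set
  IsAutomorphism σ = ∀ u v → (Adj G u v → Adj G (Inverse.to σ u) (Inverse.to σ v))
                            × (Adj G (Inverse.to σ u) (Inverse.to σ v) → Adj G u v)

  IsVertexTransitive : Set
  IsVertexTransitive = ∀ u v → ∃ λ (σ : Fin n ↔ Fin n) → IsAutomorphism σ × Inverse.to σ u ≡ v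

-- Let C be the maximal clique with |C| = n/2 and D its complement; C and D are the strong cliques of
-- the partition. Since adjacency is an arbitrary type, edges are counted in a decidable subgraph H ⊆ G:
-- the closure of the edges of C under the automorphisms that witness vertex-transitivity. H is invariant
-- under a transitive family of automorphisms, hence regular, and in a regular graph a cut into halves C, D
-- leaves equally many edges inside C and inside D (double count the edges leaving each side). C is
-- complete in H, hence so is D.
-- Both C and D are then maximal cliques (for D, an automorphism carries a non-edge between D and C to any
-- vertex of C), and a maximal clique whose complement is a clique is strong: a maximal independent set
-- avoiding it is a single vertex of the complement, and a non-neighbour of that vertex in the clique could
-- be added to it.

module Submission where

open import Data.Bool using (Bool; true; false; not; if_then_else_)
open import Data.Bool.Properties using (⇔→≡)
open import Data.Empty using (⊥-elim)
open import Data.Fin using (Fin; zero; suc; combine; remQuot)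
open import Data.Fin.Properties using (_≟_; all?; any?; ¬∀⟶∃¬; remQuot-combine)
open import Data.Fin.Subset using (Subset; _∈_; _∉_; _⊆_; _⊂_; _⊃_; _∪_; ⁅_⁆; ∁; ∣_∣; Nonempty)
open import Data.Fin.Subset.Induction using (⊃-wellFounded; Acc; acc)
open import Data.Fin.Subset.Properties
  using (_∈?_; _⊆?_; nonempty?; ⊆-trans; p⊆p∪q; x∈p∪q⁺; x∈p∪q⁻; x∈⁅x⁆; x∈⁅y⁆⇒x≡y; ∣⁅x⁆∣≡1;
         x∈∁p⇒x∉p; x∉∁p⇒x∈p; x∉p⇒x∈∁p; ∣∁p∣≡n∸∣p∣; Empty-unique; ∣⊥∣≡0)
open import Data.Nat using (ℕ; zero; suc; _+_; _*_; _∸_; _≤_; _<_; z≤n; s≤s)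
open import Data.Nat.Properties
  using (+-*-semiring; module ≤-Reasoning; ≤-refl; ≤-trans; ≤-reflexive; <-irrefl; m≤m+n; m≤n+m;
         +-comm; +-identityʳ; +-cancelʳ-≡; +-mono-≤; +-mono-<-≤; +-mono-≤-<; *-identityʳ; *-zeroʳ;
         *-distribˡ-+; *-monoˡ-≤; *-monoʳ-≤; *-monoʳ-<; m+n∸m≡n)
open import Data.Nat.Solver using (module +-*-Solver)
open import Algebra.Properties.Semiring.Sum +-*-semiring
  using (sum; sum-cong-≗; ∑-distrib-+; ∑-comm; ∑-permute; *-distribˡ-sum; *-distribʳ-sum)
open import Data.Product using (∃; _×_; _,_; proj₁; proj₂; uncurry)
open import Data.Sum using (_⊎_; inj₁; inj₂)
open import Data.Vec using ([]; _∷_; lookup; tabulate; map)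
open import Data.Vec.Properties
  using ([]=⇒lookup; lookup⇒[]=; lookup-map; lookup∘tabulate; tabulate-cong; tabulate∘lookup; tabulate-∘)
open import Function using (_∘_)
open import Function.Bundles using (_↔_; Inverse; Injection; mk⇔)
open import Function.Properties.Inverse using (↔⇒↣)
open import Relation.Nullary using (¬_; ¬?; Dec; does; yes; no; contradiction; _×-dec_)
open import Relation.Nullary.Decidable using (⌊_⌋; _→-dec_; dec-true)
open import Relation.Nullary.Negation using (¬¬-map)
open import Relation.Binary.PropositionalEquality

open import Defs hiding (sym)
open Inverse using (to; from)

sum-mono-≤ : ∀ {n} {f g : Fin n → ℕ} → (∀ i → f i ≤ g i) → sum f ≤ sum g
sum-mono-≤ {zero}  f≤g = z≤n
sum-mono-≤ {suc n} f≤g = +-mono-≤ (f≤g zero) (sum-mono-≤ λ i → f≤g (suc i))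

sum-mono-< : ∀ {n} {f g : Fin n → ℕ} → (∀ i → f i ≤ g i) → ∀ j → f j < g j → sum f < sum g
sum-mono-< f≤g zero    fj<gj = +-mono-<-≤ fj<gj (sum-mono-≤ λ i → f≤g (suc i))
sum-mono-< f≤g (suc j) fj<gj = +-mono-≤-< (f≤g zero) (sum-mono-< (λ i → f≤g (suc i)) j fj<gj)

χ : Bool → ℕ
χ true  = 1
χ false = 0

χ≤1 : ∀ b → χ b ≤ 1
χ≤1 true  = ≤-refl
χ≤1 false = z≤n

χ-not : ∀ b → χ b + χ (not b) ≡ 1
χ-not true  = refl
χ-not false = refl

sum-χ≡∣∣ : ∀ {n} (p : Subset n) → sum (λ u → χ (lookup p u)) ≡ ∣ p ∣
sum-χ≡∣∣ []          = refl
sum-χ≡∣∣ (true ∷ p)  = cong suc (sum-χ≡∣∣ p)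
sum-χ≡∣∣ (false ∷ p) = sum-χ≡∣∣ p

size² : ∀ {n} (X : Subset n) → ∣ X ∣ * ∣ X ∣ ≡ sum (λ u → χ (lookup X u) * ∣ X ∣)
size² X = trans (cong (_* ∣ X ∣) (sym (sum-χ≡∣∣ X))) (*-distribʳ-sum ∣ X ∣ λ u → χ (lookup X u))

χ-∈ : ∀ {n} {p : Subset n} {u} → u ∈ p → χ (lookup p u) ≡ 1
χ-∈ u∈p rewrite []=⇒lookup u∈p = refl

χ-∉ : ∀ {n} {p : Subset n} {u} → ¬ u ∈ p → χ (lookup p u) ≡ 0
χ-∉ {p = p} {u} u∉p with lookup p u in eq
... | true  = ⊥-elim (u∉p (lookup⇒[]= u p eq))
... | false = refl

χ-∁ : ∀ {n} (p : Subset n) u → χ (lookup p u) + χ (lookup (∁ p) u) ≡ 1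
χ-∁ p u rewrite lookup-map u not p = χ-not (lookup p u)

χ-weighted-≤ : ∀ {n} (X : Subset n) u {a b} → (u ∈ X → a ≤ b) → χ (lookup X u) * a ≤ χ (lookup X u) * b
χ-weighted-≤ X u a≤b with u ∈? X
... | yes u∈X rewrite χ-∈ u∈X = *-monoʳ-≤ 1 (a≤b u∈X)
... | no  u∉X rewrite χ-∉ u∉X = z≤n

χ-weighted-< : ∀ {n} {X : Subset n} {u a b} → u ∈ X → a < b → χ (lookup X u) * a < χ (lookup X u) * b
χ-weighted-< u∈X a<b rewrite χ-∈ u∈X = *-monoʳ-< 1 a<b

module _ {n : ℕ} (r : Fin n → Fin n → Bool) where

  degree : Fin n → ℕ
  degree u = sum λ w → χ (r u w)

  degreeIn : Subset n → Fin n → ℕ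
  degreeIn Y u = sum λ w → χ (r u w) * χ (lookup Y w)

  edges : Subset n → Subset n → ℕ
  edges X Y = sum λ u → χ (lookup X u) * degreeIn Y u

  IsCliqueᵇ : Subset n → Set
  IsCliqueᵇ X = ∀ {u v} → u ∈ X → v ∈ X → ¬ u ≡ v → r u v ≡ true

  degreeIn-∁ : ∀ Y u → degreeIn Y u + degreeIn (∁ Y) u ≡ degree u
  degreeIn-∁ Y u = begin
    degreeIn Y u + degreeIn (∁ Y) u
      ≡⟨ ∑-distrib-+ (λ w → χ (r u w) * χ (lookup Y w)) (λ w → χ (r u w) * χ (lookup (∁ Y) w)) ⟨
    sum (λ w → χ (r u w) * χ (lookup Y w) + χ (r u w) * χ (lookup (∁ Y) w))
      ≡⟨ sum-cong-≗ (λ w → trans (sym (*-distribˡ-+ (χ (r u w)) _ _))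
                                 (trans (cong (χ (r u w) *_) (χ-∁ Y w)) (*-identityʳ _))) ⟩
    degree u ∎
    where open ≡-Reasoning

  edges-∁ : ∀ X Y → edges X Y + edges X (∁ Y) ≡ sum (λ u → χ (lookup X u) * degree u)
  edges-∁ X Y = begin
    edges X Y + edges X (∁ Y)
      ≡⟨ ∑-distrib-+ (λ u → χ (lookup X u) * degreeIn Y u) (λ u → χ (lookup X u) * degreeIn (∁ Y) u) ⟨
    sum (λ u → χ (lookup X u) * degreeIn Y u + χ (lookup X u) * degreeIn (∁ Y) u)
      ≡⟨ sum-cong-≗ (λ u → trans (sym (*-distribˡ-+ (χ (lookup X u)) _ _))
                                 (cong (χ (lookup X u) *_) (degreeIn-∁ Y u))) ⟩
    sum (λ u → χ (lookup X u) * degree u) ∎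
    where open ≡-Reasoning

  edges-comm : (∀ u v → r u v ≡ r v u) → ∀ X Y → edges X Y ≡ edges Y X
  edges-comm r-sym X Y = begin
    edges X Y
      ≡⟨ sum-cong-≗ (λ u → *-distribˡ-sum (χ (lookup X u)) λ w → χ (r u w) * χ (lookup Y w)) ⟩
    sum (λ u → sum λ w → χ (lookup X u) * (χ (r u w) * χ (lookup Y w)))
      ≡⟨ ∑-comm (λ u w → χ (lookup X u) * (χ (r u w) * χ (lookup Y w))) ⟩
    sum (λ w → sum λ u → χ (lookup X u) * (χ (r u w) * χ (lookup Y w)))
      ≡⟨ sum-cong-≗ (λ w → sum-cong-≗ λ u → swap (χ (lookup X u)) (r-sym u w) (χ (lookup Y w))) ⟩
    sum (λ w → sum λ u → χ (lookup Y w) * (χ (r w u) * χ (lookup X u)))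
      ≡⟨ sum-cong-≗ (λ w → *-distribˡ-sum (χ (lookup Y w)) λ u → χ (r w u) * χ (lookup X u)) ⟨
    edges Y X ∎
    where
    open ≡-Reasoning
    open +-*-Solver
    swap : ∀ x {a b} → a ≡ b → ∀ y → x * (χ a * y) ≡ y * (χ b * x)
    swap x {a} refl y = solve 3 (λ x a y → x :* (a :* y) := y :* (a :* x)) refl x (χ a) y

  edges-regular : ∀ {δ} → (∀ u → degree u ≡ δ) → ∀ X → sum (λ u → χ (lookup X u) * degree u) ≡ ∣ X ∣ * δ
  edges-regular {δ} regular X = begin
    sum (λ u → χ (lookup X u) * degree u)  ≡⟨ sum-cong-≗ (λ u → cong (χ (lookup X u) *_) (regular u)) ⟩
    sum (λ u → χ (lookup X u) * δ)         ≡⟨ *-distribʳ-sum δ (λ u → χ (lookup X u)) ⟨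
    sum (λ u → χ (lookup X u)) * δ         ≡⟨ cong (_* δ) (sum-χ≡∣∣ X) ⟩
    ∣ X ∣ * δ                              ∎
    where open ≡-Reasoning

  edges-balanced : (∀ u v → r u v ≡ r v u) → ∀ {δ} → (∀ u → degree u ≡ δ) →
                   ∀ X → ∣ X ∣ ≡ ∣ ∁ X ∣ → edges X X ≡ edges (∁ X) (∁ X)
  edges-balanced r-sym {δ} regular X balanced = +-cancelʳ-≡ (edges (∁ X) X) _ _ (begin
    edges X X + edges (∁ X) X          ≡⟨ cong (edges X X +_) (edges-comm r-sym (∁ X) X) ⟩
    edges X X + edges X (∁ X)          ≡⟨ trans (edges-∁ X X) (edges-regular regular X) ⟩
    ∣ X ∣ * δ                          ≡⟨ cong (_* δ) balanced ⟩
    ∣ ∁ X ∣ * δ                        ≡⟨ trans (edges-∁ (∁ X) X) (edges-regular regular (∁ X)) ⟨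
    edges (∁ X) X + edges (∁ X) (∁ X)  ≡⟨ +-comm (edges (∁ X) X) _ ⟩
    edges (∁ X) (∁ X) + edges (∁ X) X  ∎)
    where open ≡-Reasoning

  degree-invariant : (π : Fin n ↔ Fin n) → (∀ u v → r (to π u) (to π v) ≡ r u v) →
                     ∀ u → degree (to π u) ≡ degree u
  degree-invariant π invariant u =
    trans (∑-permute (λ w → χ (r (to π u) w)) π) (sum-cong-≗ λ w → cong χ (invariant u w))

  degreeIn+1≡sum : ∀ X u → degreeIn X u + 1 ≡ sum (λ w → χ (r u w) * χ (lookup X w) + χ (lookup ⁅ u ⁆ w))
  degreeIn+1≡sum X u = sym (trans (∑-distrib-+ (λ w → χ (r u w) * χ (lookup X w)) (λ w → χ (lookup ⁅ u ⁆ w)))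
                                  (cong (degreeIn X u +_) (trans (sum-χ≡∣∣ ⁅ u ⁆) (∣⁅x⁆∣≡1 u))))

  clique-degreeIn : ∀ {X u} → IsCliqueᵇ X → u ∈ X → ∣ X ∣ ≤ degreeIn X u + 1
  clique-degreeIn {X} {u} clique u∈X = begin
    ∣ X ∣                                                        ≡⟨ sum-χ≡∣∣ X ⟨
    sum (λ w → χ (lookup X w))                                   ≤⟨ sum-mono-≤ summand≥ ⟩
    sum (λ w → χ (r u w) * χ (lookup X w) + χ (lookup ⁅ u ⁆ w))  ≡⟨ degreeIn+1≡sum X u ⟨
    degreeIn X u + 1                                             ∎
    where
    open ≤-Reasoning
    summand≥ : ∀ w → χ (lookup X w) ≤ χ (r u w) * χ (lookup X w) + χ (lookup ⁅ u ⁆ w)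
    summand≥ w with w ∈? X | u ≟ w
    ... | no  w∉X | _        rewrite χ-∉ w∉X = z≤n
    ... | yes w∈X | yes refl rewrite χ-∈ w∈X | χ-∈ (x∈⁅x⁆ u) = m≤n+m 1 _
    ... | yes w∈X | no  u≢w  rewrite χ-∈ w∈X | clique u∈X w∈X u≢w = m≤m+n 1 _

  module _ (r-irrefl : ∀ u → r u u ≡ false) {X : Subset n} {u : Fin n} (u∈X : u ∈ X) where

    private
      summand≤ : ∀ w → χ (r u w) * χ (lookup X w) + χ (lookup ⁅ u ⁆ w) ≤ χ (lookup X w)
      summand≤ w with w ∈? X | u ≟ w
      ... | yes w∈X | yes refl rewrite χ-∈ w∈X | r-irrefl u | χ-∈ (x∈⁅x⁆ u) = ≤-refl
      ... | yes w∈X | no  u≢w  rewrite χ-∈ w∈X | χ-∉ (u≢w ∘ sym ∘ x∈⁅y⁆⇒x≡y u) =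
              ≤-trans (≤-reflexive (+-identityʳ _)) (*-monoˡ-≤ 1 (χ≤1 (r u w)))
      ... | no  w∉X | yes refl = ⊥-elim (w∉X u∈X)
      ... | no  w∉X | no  u≢w  rewrite χ-∉ w∉X | χ-∉ (u≢w ∘ sym ∘ x∈⁅y⁆⇒x≡y u) | *-zeroʳ (χ (r u w)) = ≤-refl

    degreeIn-irreflexive : degreeIn X u + 1 ≤ ∣ X ∣
    degreeIn-irreflexive = begin
      degreeIn X u + 1                                             ≡⟨ degreeIn+1≡sum X u ⟩
      sum (λ w → χ (r u w) * χ (lookup X w) + χ (lookup ⁅ u ⁆ w))  ≤⟨ sum-mono-≤ summand≤ ⟩
      sum (λ w → χ (lookup X w))                                   ≡⟨ sum-χ≡∣∣ X ⟩
      ∣ X ∣                                                        ∎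
      where open ≤-Reasoning

    degreeIn-nonEdge : ∀ {d} → d ∈ X → ¬ u ≡ d → r u d ≡ false → degreeIn X u + 1 < ∣ X ∣
    degreeIn-nonEdge {d} d∈X u≢d rud≡false = begin-strict
      degreeIn X u + 1                                             ≡⟨ degreeIn+1≡sum X u ⟩
      sum (λ w → χ (r u w) * χ (lookup X w) + χ (lookup ⁅ u ⁆ w))  <⟨ sum-mono-< summand≤ d summand< ⟩
      sum (λ w → χ (lookup X w))                                   ≡⟨ sum-χ≡∣∣ X ⟩
      ∣ X ∣                                                        ∎
      where
      open ≤-Reasoning
      summand< : χ (r u d) * χ (lookup X d) + χ (lookup ⁅ u ⁆ d) < χ (lookup X d)
      summand< rewrite rud≡false | χ-∈ d∈X | χ-∉ (u≢d ∘ sym ∘ x∈⁅y⁆⇒x≡y u) = s≤s z≤n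

  edges-diagonal : ∀ X → edges X X + ∣ X ∣ ≡ sum (λ u → χ (lookup X u) * (degreeIn X u + 1))
  edges-diagonal X = begin
    edges X X + ∣ X ∣
      ≡⟨ cong (edges X X +_) (sum-χ≡∣∣ X) ⟨
    edges X X + sum (λ u → χ (lookup X u))
      ≡⟨ ∑-distrib-+ (λ u → χ (lookup X u) * degreeIn X u) (λ u → χ (lookup X u)) ⟨
    sum (λ u → χ (lookup X u) * degreeIn X u + χ (lookup X u))
      ≡⟨ sum-cong-≗ (λ u → trans (cong (χ (lookup X u) * degreeIn X u +_) (sym (*-identityʳ _)))
                                 (sym (*-distribˡ-+ (χ (lookup X u)) _ 1))) ⟩
    sum (λ u → χ (lookup X u) * (degreeIn X u + 1)) ∎
    where open ≡-Reasoning

  clique-edges : ∀ {X} → IsCliqueᵇ X → ∣ X ∣ * ∣ X ∣ ≤ edges X X + ∣ X ∣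
  clique-edges {X} clique = begin
    ∣ X ∣ * ∣ X ∣
      ≡⟨ size² X ⟩
    sum (λ u → χ (lookup X u) * ∣ X ∣)
      ≤⟨ sum-mono-≤ (λ u → χ-weighted-≤ X u (clique-degreeIn clique)) ⟩
    sum (λ u → χ (lookup X u) * (degreeIn X u + 1))
      ≡⟨ edges-diagonal X ⟨
    edges X X + ∣ X ∣ ∎
    where open ≤-Reasoning

  nonEdge-edges : (∀ u → r u u ≡ false) → ∀ {X u d} → u ∈ X → d ∈ X → ¬ u ≡ d → r u d ≡ false →
                  edges X X + ∣ X ∣ < ∣ X ∣ * ∣ X ∣
  nonEdge-edges r-irrefl {X} {u} u∈X d∈X u≢d rud≡false = begin-strict
    edges X X + ∣ X ∣
      ≡⟨ edges-diagonal X ⟩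
    sum (λ w → χ (lookup X w) * (degreeIn X w + 1))
      <⟨ sum-mono-< (λ w → χ-weighted-≤ X w (degreeIn-irreflexive r-irrefl)) u
                    (χ-weighted-< u∈X (degreeIn-nonEdge r-irrefl u∈X d∈X u≢d rud≡false)) ⟩
    sum (λ w → χ (lookup X w) * ∣ X ∣)
      ≡⟨ size² X ⟨
    ∣ X ∣ * ∣ X ∣ ∎
    where open ≤-Reasoning

  regular-balanced-∁-clique : (∀ u v → r u v ≡ r v u) → (∀ u → r u u ≡ false) → ∀ {δ} → (∀ u → degree u ≡ δ) →
                              ∀ {X} → IsCliqueᵇ X → ∣ X ∣ ≡ ∣ ∁ X ∣ → IsCliqueᵇ (∁ X)
  regular-balanced-∁-clique r-sym r-irrefl regular {X} clique balanced {u} {v} u∈∁X v∈∁X u≢v with r u v in ruv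
  ... | true  = refl
  ... | false = ⊥-elim (<-irrefl refl (begin-strict
    ∣ X ∣ * ∣ X ∣                  ≤⟨ clique-edges clique ⟩
    edges X X + ∣ X ∣              ≡⟨ cong₂ _+_ (edges-balanced r-sym regular X balanced) balanced ⟩
    edges (∁ X) (∁ X) + ∣ ∁ X ∣    <⟨ nonEdge-edges r-irrefl u∈∁X v∈∁X u≢v ruv ⟩
    ∣ ∁ X ∣ * ∣ ∁ X ∣              ≡⟨ cong₂ _*_ balanced balanced ⟨
    ∣ X ∣ * ∣ X ∣                  ∎))
    where open ≤-Reasoning

⊆∧⊈⇒⊂ : ∀ {m} {p q : Subset m} → p ⊆ q → ¬ q ⊆ p → p ⊂ q
⊆∧⊈⇒⊂ {m} {p} {q} p⊆q q⊈p with ¬∀⟶∃¬ m _ (λ x → x ∈? q →-dec x ∈? p) (λ q⊆p → q⊈p (q⊆p _))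
... | x , x∈q⇏x∈p with x ∈? q
...   | yes x∈q = p⊆q , x , x∈q , x∈q⇏x∈p ∘ λ x∈p _ → x∈p
...   | no  x∉q = contradiction (λ x∈q → contradiction x∈q x∉q) x∈q⇏x∈p

module _ {m k ℓ} (F : Fin k → Subset m → Subset m) (F-inflationary : ∀ j p → p ⊆ F j p)
         (P : Subset m → Set ℓ) (F-preserves : ∀ j {p} → P p → P (F j p)) where

  ∃-common-postfixpoint : ∀ {p} → P p → ∃ λ q → P q × p ⊆ q × (∀ j → F j q ⊆ q)
  ∃-common-postfixpoint {p} = go (⊃-wellFounded p)
    where
    go : ∀ {p} → Acc _⊃_ p → P p → ∃ λ q → P q × p ⊆ q × (∀ j → F j q ⊆ q)
    go {p} (acc larger) Pp with all? (λ j → F j p ⊆? p)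
    ... | yes closed = p , Pp , (λ x∈p → x∈p) , closed
    ... | no ¬closed with ¬∀⟶∃¬ k _ (λ j → F j p ⊆? p) ¬closed
    ...   | j , Fjp⊈p with go (larger (⊆∧⊈⇒⊂ (F-inflationary j p) Fjp⊈p)) (F-preserves j Pp)
    ...     | q , Pq , Fjp⊆q , closed = q , Pq , ⊆-trans (F-inflationary j p) Fjp⊆q , closed

-- A decidable relation on Fin n is stored as a subset of Fin (n * n), so that the well-foundedness of ⊂ on
-- subsets bounds the saturation under automorphisms.
_∈²_ : ∀ {n} → Fin n × Fin n → Subset (n * n) → Set
(u , v) ∈² p = combine u v ∈ p

module _ {n : ℕ} where

  pairs : {P : Fin n → Fin n → Set} → (∀ u v → Dec (P u v)) → Subset (n * n)
  pairs P? = tabulate (λ i → does (uncurry P? (remQuot n i)))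

  module _ {P : Fin n → Fin n → Set} (P? : ∀ u v → Dec (P u v)) {u v : Fin n} where

    private
      lookup-pairs : lookup (pairs P?) (combine u v) ≡ does (P? u v)
      lookup-pairs = trans (lookup∘tabulate _ (combine u v))
                           (cong (λ uv → does (uncurry P? uv)) (remQuot-combine u v))

    ∈-pairs⁺ : P u v → (u , v) ∈² pairs P?
    ∈-pairs⁺ Puv = lookup⇒[]= (combine u v) (pairs P?) (trans lookup-pairs (dec-true (P? u v) Puv))

    ∈-pairs⁻ : (u , v) ∈² pairs P? → P u v
    ∈-pairs⁻ uv∈pairs with P? u v | trans (sym lookup-pairs) ([]=⇒lookup uv∈pairs)
    ... | yes Puv | _ = Puv
    ... | no  _   | ()

  pull : (Fin n → Fin n) → Subset (n * n) → Subset (n * n)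
  pull f p = pairs (λ u v → combine (f u) (f v) ∈? p)

  module _ (f : Fin n → Fin n) {p : Subset (n * n)} {u v : Fin n} where

    ∈-pull⁺ : (f u , f v) ∈² p → (u , v) ∈² pull f p
    ∈-pull⁺ = ∈-pairs⁺ (λ x y → combine (f x) (f y) ∈? p)

    ∈-pull⁻ : (u , v) ∈² pull f p → (f u , f v) ∈² p
    ∈-pull⁻ = ∈-pairs⁻ (λ x y → combine (f x) (f y) ∈? p)

module _ {n : ℕ} (C : Subset n) where

  distinctPair? : ∀ u v → Dec (u ∈ C × v ∈ C × ¬ u ≡ v)
  distinctPair? u v = (u ∈? C) ×-dec (v ∈? C) ×-dec ¬? (u ≟ v)

  distinctPairs : Subset (n * n)
  distinctPairs = pairs distinctPair?

module _ {n : ℕ} (G : Graph n) where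

  IsSymmetricEdgeSet : Subset (n * n) → Set
  IsSymmetricEdgeSet p = (∀ {u v : Fin n} → (u , v) ∈² p → Adj G u v)
                       × (∀ {u v : Fin n} → (u , v) ∈² p → (v , u) ∈² p)

  distinctPairs-symmetricEdgeSet : ∀ {C} → IsClique G C → IsSymmetricEdgeSet (distinctPairs C)
  distinctPairs-symmetricEdgeSet {C} clique = ⊆Adj , symmetric
    where
    ⊆Adj : ∀ {u v : Fin n} → (u , v) ∈² distinctPairs C → Adj G u v
    ⊆Adj uv∈ with u∈C , v∈C , u≢v ← ∈-pairs⁻ (distinctPair? C) uv∈ = clique u∈C v∈C u≢v
    symmetric : ∀ {u v : Fin n} → (u , v) ∈² distinctPairs C → (v , u) ∈² distinctPairs C
    symmetric uv∈ with u∈C , v∈C , u≢v ← ∈-pairs⁻ (distinctPair? C) uv∈ =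
      ∈-pairs⁺ (distinctPair? C) (v∈C , u∈C , u≢v ∘ sym)

  saturate : (Fin n ↔ Fin n) → Subset (n * n) → Subset (n * n)
  saturate π p = p ∪ pull (to π) p ∪ pull (from π) p

  module _ (π : Fin n ↔ Fin n) where

    saturate-inflationary : ∀ p → p ⊆ saturate π p
    saturate-inflationary p = p⊆p∪q _

    ∈-saturate⁻ : ∀ {p} {u v : Fin n} → (u , v) ∈² saturate π p →
                  (u , v) ∈² p ⊎ (to π u , to π v) ∈² p ⊎ (from π u , from π v) ∈² p
    ∈-saturate⁻ {p} uv∈ with x∈p∪q⁻ p _ uv∈
    ... | inj₁ uv∈p = inj₁ uv∈p
    ... | inj₂ uv∈pulls with x∈p∪q⁻ (pull (to π) p) _ uv∈pulls
    ...   | inj₁ πuv∈p   = inj₂ (inj₁ (∈-pull⁻ (to π) πuv∈p))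
    ...   | inj₂ π⁻¹uv∈p = inj₂ (inj₂ (∈-pull⁻ (from π) π⁻¹uv∈p))

    saturate-preserves : IsAutomorphism G π → ∀ {p} → IsSymmetricEdgeSet p → IsSymmetricEdgeSet (saturate π p)
    saturate-preserves aut {p} (p⊆Adj , p-sym) = ⊆Adj , symmetric
      where
      ⊆Adj : ∀ {u v : Fin n} → (u , v) ∈² saturate π p → Adj G u v
      ⊆Adj {u} {v} uv∈ with ∈-saturate⁻ uv∈
      ... | inj₁ uv∈p           = p⊆Adj uv∈p
      ... | inj₂ (inj₁ πuv∈p)   = proj₂ (aut u v) (p⊆Adj πuv∈p)
      ... | inj₂ (inj₂ π⁻¹uv∈p) = subst₂ (Adj G) (Inverse.strictlyInverseˡ π u) (Inverse.strictlyInverseˡ π v)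
                                         (proj₁ (aut _ _) (p⊆Adj π⁻¹uv∈p))
      symmetric : ∀ {u v : Fin n} → (u , v) ∈² saturate π p → (v , u) ∈² saturate π p
      symmetric uv∈ with ∈-saturate⁻ uv∈
      ... | inj₁ uv∈p           = x∈p∪q⁺ (inj₁ (p-sym uv∈p))
      ... | inj₂ (inj₁ πuv∈p)   = x∈p∪q⁺ (inj₂ (x∈p∪q⁺ (inj₁ (∈-pull⁺ (to π) (p-sym πuv∈p)))))
      ... | inj₂ (inj₂ π⁻¹uv∈p) = x∈p∪q⁺ (inj₂ (x∈p∪q⁺ (inj₂ (∈-pull⁺ (from π) (p-sym π⁻¹uv∈p)))))

    module _ {q : Subset (n * n)} (closed : saturate π q ⊆ q) {u v : Fin n} where

      saturated-to⁻ : (to π u , to π v) ∈² q → (u , v) ∈² q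
      saturated-to⁻ πuv∈q = closed (x∈p∪q⁺ (inj₂ (x∈p∪q⁺ (inj₁ (∈-pull⁺ (to π) πuv∈q)))))

      saturated-to⁺ : (u , v) ∈² q → (to π u , to π v) ∈² q
      saturated-to⁺ uv∈q = closed (x∈p∪q⁺ (inj₂ (x∈p∪q⁺ (inj₂ (∈-pull⁺ (from π) π⁻¹πuv∈q)))))
        where
        π⁻¹πuv∈q : (from π (to π u) , from π (to π v)) ∈² q
        π⁻¹πuv∈q = subst₂ (λ x y → (x , y) ∈² q)
                          (sym (Inverse.strictlyInverseʳ π u)) (sym (Inverse.strictlyInverseʳ π v)) uv∈q

  subgraph-irreflexive : ∀ {r : Fin n → Fin n → Bool} → (∀ {u v} → r u v ≡ true → Adj G u v) →
                         ∀ u → r u u ≡ false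
  subgraph-irreflexive {r} r⊆Adj u with r u u in ruu
  ... | true  = ⊥-elim (Graph.irrefl G (r⊆Adj ruu))
  ... | false = refl

¬¬-shift : ∀ {n} {P : Fin n → Set} → (∀ i → ¬ ¬ P i) → ¬ ¬ (∀ i → P i)
¬¬-shift {zero}  ¬¬P ¬∀P = ¬∀P λ ()
¬¬-shift {suc n} ¬¬P ¬∀P = ¬¬P zero λ P₀ → ¬¬-shift (λ i → ¬¬P (suc i)) λ ∀P → ¬∀P λ where
  zero    → P₀
  (suc i) → ∀P i

module _ {n : ℕ} (G : Graph n) where

  HasNonNeighbourIn : Subset n → Fin n → Set
  HasNonNeighbourIn K w = ∃ λ c → c ∈ K × ¬ Adj G c w

  clique-∪-⁅⁆ : ∀ {K w} → IsClique G K → (∀ {c} → c ∈ K → Adj G c w) → IsClique G (K ∪ ⁅ w ⁆)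
  clique-∪-⁅⁆ {K} {w} clique adjacent {u} {v} u∈ v∈ u≢v with x∈p∪q⁻ K ⁅ w ⁆ u∈ | x∈p∪q⁻ K ⁅ w ⁆ v∈
  ... | inj₁ u∈K | inj₁ v∈K = clique u∈K v∈K u≢v
  ... | inj₁ u∈K | inj₂ v∈w rewrite x∈⁅y⁆⇒x≡y w v∈w = adjacent u∈K
  ... | inj₂ u∈w | inj₁ v∈K rewrite x∈⁅y⁆⇒x≡y w u∈w = Graph.sym G (adjacent v∈K)
  ... | inj₂ u∈w | inj₂ v∈w = contradiction (trans (x∈⁅y⁆⇒x≡y w u∈w) (sym (x∈⁅y⁆⇒x≡y w v∈w))) u≢v

  independent-∪-⁅⁆ : ∀ {I w} → IsIndependent G I → (∀ {u} → u ∈ I → ¬ Adj G u w) → IsIndependent G (I ∪ ⁅ w ⁆)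
  independent-∪-⁅⁆ {I} {w} independent nonAdjacent {u} {v} u∈ v∈ with x∈p∪q⁻ I ⁅ w ⁆ u∈ | x∈p∪q⁻ I ⁅ w ⁆ v∈
  ... | inj₁ u∈I | inj₁ v∈I = independent u∈I v∈I
  ... | inj₁ u∈I | inj₂ v∈w rewrite x∈⁅y⁆⇒x≡y w v∈w = nonAdjacent u∈I
  ... | inj₂ u∈w | inj₁ v∈I rewrite x∈⁅y⁆⇒x≡y w u∈w = nonAdjacent v∈I ∘ Graph.sym G
  ... | inj₂ u∈w | inj₂ v∈w rewrite x∈⁅y⁆⇒x≡y w u∈w | x∈⁅y⁆⇒x≡y w v∈w = Graph.irrefl G

  maximalIndependent-∈ : ∀ {I c} → IsMaximalIndependent G I → (∀ {u} → u ∈ I → ¬ Adj G u c) → c ∈ I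
  maximalIndependent-∈ {I} {c} (independent , maximal) nonAdjacent =
    maximal (I ∪ ⁅ c ⁆) (independent-∪-⁅⁆ independent nonAdjacent) (p⊆p∪q ⁅ c ⁆) (x∈p∪q⁺ (inj₂ (x∈⁅x⁆ c)))

  -- Adjacency is not decidable, so the non-neighbour exists only up to double negation; it is only ever used
  -- to refute something.
  maximalClique⇒nonNeighbour : ∀ {K w} → IsMaximalClique G K → w ∉ K → ¬ ¬ HasNonNeighbourIn K w
  maximalClique⇒nonNeighbour {K} {w} (clique , maximal) w∉K ¬nonNeighbour = ¬¬-shift adjacent? λ adjacent →
    w∉K (maximal (K ∪ ⁅ w ⁆) (clique-∪-⁅⁆ clique λ {c} → adjacent c) (p⊆p∪q ⁅ w ⁆) (x∈p∪q⁺ (inj₂ (x∈⁅x⁆ w))))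
    where
    adjacent? : ∀ c → ¬ ¬ (c ∈ K → Adj G c w)
    adjacent? c with c ∈? K
    ... | yes c∈K = λ ¬adjacent → ¬nonNeighbour (c , c∈K , λ adj → ¬adjacent λ _ → adj)
    ... | no  c∉K = λ ¬adjacent → ¬adjacent λ c∈K → contradiction c∈K c∉K

  nonNeighbour⇒maximalClique : ∀ {K} → IsClique G K → (∀ {w} → w ∉ K → ¬ ¬ HasNonNeighbourIn K w) →
                               IsMaximalClique G K
  nonNeighbour⇒maximalClique {K} clique nonNeighbour = clique , maximal
    where
    maximal : ∀ E → IsClique G E → K ⊆ E → E ⊆ K
    maximal E E-clique K⊆E {x} x∈E with x ∈? K
    ... | yes x∈K = x∈K
    ... | no  x∉K = ⊥-elim (nonNeighbour x∉K λ (c , c∈K , ¬adj) →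
                      ¬adj (E-clique (K⊆E c∈K) x∈E λ { refl → x∉K c∈K }))

  maximalIndependent-nonempty : Fin n → ∀ {I} → IsMaximalIndependent G I → Nonempty I
  maximalIndependent-nonempty v {I} (_ , maximal) with nonempty? I
  ... | yes nonempty = nonempty
  ... | no  empty    = v , maximal ⁅ v ⁆ singleton-independent (λ x∈I → contradiction (_ , x∈I) empty) (x∈⁅x⁆ v)
    where
    singleton-independent : IsIndependent G ⁅ v ⁆
    singleton-independent u∈ v∈ rewrite x∈⁅y⁆⇒x≡y v u∈ | x∈⁅y⁆⇒x≡y v v∈ = Graph.irrefl G

  maximalClique-strong : Fin n → ∀ {K} → IsMaximalClique G K → IsClique G (∁ K) → IsStrongClique G K
  maximalClique-strong v {K} K-maximal ∁K-clique = proj₁ K-maximal , meets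
    where
    meets : ∀ I → IsMaximalIndependent G I → ∃ λ u → u ∈ K × u ∈ I
    meets I I-maximal with any? (λ u → u ∈? K ×-dec u ∈? I)
    ... | yes meet = meet
    ... | no ¬meet with w , w∈I ← maximalIndependent-nonempty v I-maximal =
      ⊥-elim (maximalClique⇒nonNeighbour K-maximal (∉K w∈I) λ (c , c∈K , ¬adj) →
        ¬meet (c , c∈K , maximalIndependent-∈ I-maximal (¬Adj-I ¬adj)))
      where
      ∉K : ∀ {u} → u ∈ I → u ∉ K
      ∉K u∈I u∈K = ¬meet (_ , u∈K , u∈I)
      ¬Adj-I : ∀ {c} → ¬ Adj G c w → ∀ {u} → u ∈ I → ¬ Adj G u c
      ¬Adj-I ¬adj {u} u∈I with u ≟ w
      ... | yes refl = ¬adj ∘ Graph.sym G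
      ... | no  u≢w  = ⊥-elim (proj₁ I-maximal u∈I w∈I
                                (∁K-clique (x∉p⇒x∈∁p (∉K u∈I)) (x∉p⇒x∈∁p (∉K w∈I)) u≢w))

module _ {n : ℕ} (G : Graph n) (vt : IsVertexTransitive G) where

  private
    automorphism : Fin (n * n) → Fin n ↔ Fin n
    automorphism i = proj₁ (uncurry vt (remQuot n i))

    automorphism-moves : ∀ a b → to (automorphism (combine a b)) a ≡ b
    automorphism-moves a b =
      subst (λ ab → to (proj₁ (uncurry vt ab)) a ≡ b) (sym (remQuot-combine a b)) (proj₂ (proj₂ (vt a b)))

    automorphism-isAutomorphism : ∀ i → IsAutomorphism G (automorphism i)
    automorphism-isAutomorphism i = proj₁ (proj₂ (uncurry vt (remQuot n i)))

  ∃-regularSubgraph : ∀ {C} → IsClique G C →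
    ∃ λ (r : Fin n → Fin n → Bool) → (∀ u v → r u v ≡ r v u) × (∀ {u v} → r u v ≡ true → Adj G u v)
                                    × IsCliqueᵇ r C × (∀ u v → degree r u ≡ degree r v)
  ∃-regularSubgraph {C} clique
    with q , (q⊆Adj , q-sym) , C⊆q , closed ←
           ∃-common-postfixpoint (saturate G ∘ automorphism) (saturate-inflationary G ∘ automorphism)
                                 (IsSymmetricEdgeSet G)
                                 (λ i → saturate-preserves G (automorphism i) (automorphism-isAutomorphism i))
                                 (distinctPairs-symmetricEdgeSet G clique)
    = r , r-sym , q⊆Adj ∘ r⇒∈ , r-clique , regular
    where
    r : Fin n → Fin n → Bool
    r u v = lookup q (combine u v)
    ∈⇒r : ∀ {u v} → (u , v) ∈² q → r u v ≡ true
    ∈⇒r = []=⇒lookup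
    r⇒∈ : ∀ {u v} → r u v ≡ true → (u , v) ∈² q
    r⇒∈ = lookup⇒[]= _ q
    r-clique : IsCliqueᵇ r C
    r-clique u∈C v∈C u≢v = ∈⇒r (C⊆q (∈-pairs⁺ (distinctPair? C) (u∈C , v∈C , u≢v)))
    r-sym : ∀ u v → r u v ≡ r v u
    r-sym u v = ⇔→≡ (mk⇔ (∈⇒r ∘ q-sym ∘ r⇒∈) (∈⇒r ∘ q-sym ∘ r⇒∈))
    r-invariant : ∀ i u v → r (to (automorphism i) u) (to (automorphism i) v) ≡ r u v
    r-invariant i u v = ⇔→≡ (mk⇔ (∈⇒r ∘ saturated-to⁻ G (automorphism i) (closed i) ∘ r⇒∈)
                                 (∈⇒r ∘ saturated-to⁺ G (automorphism i) (closed i) ∘ r⇒∈))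
    regular : ∀ u v → degree r u ≡ degree r v
    regular u v = trans (cong (degree r) (sym (automorphism-moves v u)))
                        (degree-invariant r (automorphism (combine v u)) (r-invariant (combine v u)) v)

  vertexTransitive-∁-clique : ∀ {C} → IsClique G C → ∣ C ∣ ≡ ∣ ∁ C ∣ → IsClique G (∁ C)
  vertexTransitive-∁-clique clique balanced {u} u∈∁C v∈∁C u≢v
    with r , r-sym , r⊆Adj , r-clique , regular ← ∃-regularSubgraph clique =
    r⊆Adj (regular-balanced-∁-clique r r-sym (subgraph-irreflexive G r⊆Adj) (λ w → regular w u)
                                     r-clique balanced u∈∁C v∈∁C u≢v)

  nonNeighbour-transport : ∀ {c d} → ¬ c ≡ d → ¬ Adj G c d → ∀ w → ∃ λ x → ¬ x ≡ w × ¬ Adj G x w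
  nonNeighbour-transport {c} {d} c≢d ¬adj w with σ , σ-aut , σd≡w ← vt d w =
    to σ c ,
    (λ σc≡w → c≢d (Injection.injective (↔⇒↣ σ) (trans σc≡w (sym σd≡w)))) ,
    (λ adj → ¬adj (proj₂ (σ-aut c d) (subst (Adj G (to σ c)) (sym σd≡w) adj)))

  ∁-maximalClique : ∀ {C} → IsMaximalClique G C → ∣ C ∣ ≡ ∣ ∁ C ∣ → Nonempty (∁ C) → IsMaximalClique G (∁ C)
  ∁-maximalClique {C} C-maximal@(C-clique , _) balanced (d , d∈∁C) =
    nonNeighbour⇒maximalClique G (vertexTransitive-∁-clique C-clique balanced) nonNeighbour
    where
    nonNeighbour : ∀ {w} → w ∉ ∁ C → ¬ ¬ HasNonNeighbourIn G (∁ C) w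
    nonNeighbour {w} w∉∁C = ¬¬-map transport (maximalClique⇒nonNeighbour G C-maximal (x∈∁p⇒x∉p d∈∁C))
      where
      transport : HasNonNeighbourIn G C d → HasNonNeighbourIn G (∁ C) w
      transport (c , c∈C , ¬adj)
        with x , x≢w , ¬adjx ← nonNeighbour-transport (λ { refl → x∈∁p⇒x∉p d∈∁C c∈C }) ¬adj w =
        x , x∉p⇒x∈∁p (λ x∈C → ¬adjx (C-clique x∈C (x∉∁p⇒x∈p w∉∁C) x≢w)) , ¬adjx

half-∣∁∣ : ∀ {n} (p : Subset n) → 2 * ∣ p ∣ ≡ n → ∣ p ∣ ≡ ∣ ∁ p ∣
half-∣∁∣ {n} p half = sym (begin
  ∣ ∁ p ∣                        ≡⟨ ∣∁p∣≡n∸∣p∣ p ⟩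
  n ∸ ∣ p ∣                      ≡⟨ cong (_∸ ∣ p ∣) half ⟨
  ∣ p ∣ + (∣ p ∣ + 0) ∸ ∣ p ∣    ≡⟨ m+n∸m≡n ∣ p ∣ _ ⟩
  ∣ p ∣ + 0                      ≡⟨ +-identityʳ ∣ p ∣ ⟩
  ∣ p ∣                          ∎)
  where open ≡-Reasoning

half-∁-nonempty : ∀ {n} (p : Subset (suc n)) → 2 * ∣ p ∣ ≡ suc n → Nonempty (∁ p)
half-∁-nonempty {n} p half with nonempty? (∁ p)
... | yes nonempty = nonempty
... | no  empty with () ← trans (sym half) (cong (2 *_) (trans (half-∣∁∣ p half)
                                   (trans (cong ∣_∣ (Empty-unique empty)) (∣⊥∣≡0 (suc n)))))

twoStrongCliques⇒localizable : ∀ {n} (G : Graph n) {K} → IsStrongClique G K → IsStrongClique G (∁ K) →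
                               IsLocalizable G
twoStrongCliques⇒localizable {n} G {K} K-strong ∁K-strong = 2 , side , λ where
    zero       → subst (IsStrongClique G) (sym classOf-zero) K-strong
    (suc zero) → subst (IsStrongClique G) (sym classOf-one) ∁K-strong
  where
  side : Fin n → Fin 2
  side v = if lookup K v then zero else suc zero
  side-zero : ∀ v → ⌊ side v ≟ zero ⌋ ≡ lookup K v
  side-zero v with lookup K v
  ... | true  = refl
  ... | false = refl
  side-one : ∀ v → ⌊ side v ≟ suc zero ⌋ ≡ not (lookup K v)
  side-one v with lookup K v
  ... | true  = refl
  ... | false = refl
  classOf-zero : classOf G side zero ≡ K
  classOf-zero = trans (tabulate-cong side-zero) (tabulate∘lookup K)
  classOf-one : classOf G side (suc zero) ≡ ∁ K
  classOf-one = trans (tabulate-cong side-one)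
                      (trans (tabulate-∘ not (lookup K)) (cong (map not) (tabulate∘lookup K)))

corollary3p4 : ∀ {n : ℕ} (G : Graph n) → IsVertexTransitive G
    → (∃ λ (C : Subset n) → IsMaximalClique G C × 2 * ∣ C ∣ ≡ n)
    → IsLocalizable G
corollary3p4 {zero}  G vt _ = 0 , (λ ()) , (λ ())
corollary3p4 {suc _} G vt (C , C-maximal , half) =
  twoStrongCliques⇒localizable G (maximalClique-strong G zero C-maximal (proj₁ ∁C-maximal))
                                 (maximalClique-strong G zero ∁C-maximal ∁∁C-clique)
  where
  ∁C-maximal : IsMaximalClique G (∁ C)
  ∁C-maximal = ∁-maximalClique G vt C-maximal (half-∣∁∣ C half) (half-∁-nonempty C half)
  ∁∁C-clique : IsClique G (∁ (∁ C))
  ∁∁C-clique u∈ v∈ = proj₁ C-maximal (x∉∁p⇒x∈p (x∈∁p⇒x∉p u∈)) (x∉∁p⇒x∈p (x∈∁p⇒x∉p v∈))
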